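{- Let $G$ be a connected graph of order $n\ge 2$ and let $H$ be any graph. If $n>\beta(H)\ge 2$, then $pd(G\odot H)\ge \beta(H)+1$.
   Context: $\beta(H)$ denotes the number of isolated vertices of $H$. For a connected graph $F$ and an ordered partition $\Pi=\{P_1,\dots,P_t\}$ of $V(F)$, $r(v|\Pi)=(d(v,P_1),\dots,d(v,P_t))$ where $d$ is shortest-path distance and $d(v,P_i)=\min_{u\in P_i}d(v,u)$; $\Pi$ is a resolving partition if $r(u|\Pi)\ne r(v|\Pi)$ for all distinct vertices $u,v$; $pd(F)$ is the minimum number of sets in a resolving partition. For graphs $G$ of order $n_1$ (vertices $v_1,\dots,v_{n_1}$) and $H$, the corona product $G\odot H$ is obtained from one copy of $G$ and $n_1$ copies $H_1,\dots,H_{n_1}$ of $H$ by joining $v_i$ to every vertex of $H_i$. -}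

module Defs where

open import Data.Nat using (ℕ; zero; suc; _≤_)
open import Data.Fin using (Fin; _≟_)
open import Data.Fin.Properties using ()
open import Data.Bool using (Bool; true; false; T; not; _∧_)
open import Data.List using (List; length; filterᵇ; allFin)
open import Data.Bool.ListAction using (all)
open import Data.Product using (Σ; ∃; _×_; _,_)
open import Data.Sum using (_⊎_; inj₁; inj₂)
open import Relation.Nullary using (¬_)
open import Relation.Nullary.Decidable using (⌊_⌋)
open import Relation.Binary.PropositionalEquality using (_≡_)
open import Function.Definitions using (Surjective)

Adjacency : Set → Set
Adjacency V = V → V → Bool

IsSimple : {V : Set} → Adjacency V → Set
IsSimple {V} adj = (∀ u v → adj u v ≡ adj v u) × (∀ v → adj v v ≡ false)

data Walk {V : Set} (adj : Adjacency V) : V → V → ℕ → Set where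
  here : ∀ {v} → Walk adj v v zero
  step : ∀ {u w v k} → T (adj u w) → Walk adj w v k → Walk adj u v (suc k)

Connected : {V : Set} → Adjacency V → Set
Connected {V} adj = ∀ (u v : V) → ∃ λ k → Walk adj u v k

Dist : {V : Set} → Adjacency V → V → V → ℕ → Set
Dist adj u v k = Walk adj u v k × (∀ m → Walk adj u v m → k ≤ m)

SetDist : {V : Set} {t : ℕ} → Adjacency V → (V → Fin t) → Fin t → V → ℕ → Set
SetDist {V} adj part i v k =
  (Σ V λ u → part u ≡ i × Dist adj v u k)
  × (∀ (u : V) m → part u ≡ i → Dist adj v u m → k ≤ m)

SameRep : {V : Set} {t : ℕ} → Adjacency V → (V → Fin t) → V → V → Set
SameRep adj part u v =
  ∀ i a b → SetDist adj part i u a → SetDist adj part i v b → a ≡ b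

-- ordered partition Π = {P_1,…,P_t}: each vertex in exactly one part, parts nonempty
IsResolvingPartition : {V : Set} → Adjacency V → (t : ℕ) → (V → Fin t) → Set
IsResolvingPartition {V} adj t part =
  Surjective _≡_ _≡_ part
  × (∀ (u v : V) → ¬ (u ≡ v) → ¬ SameRep adj part u v)

isIsolated : {m : ℕ} → Adjacency (Fin m) → Fin m → Bool
isIsolated {m} adj v = all (λ u → not (adj v u)) (allFin m)

β : {m : ℕ} → Adjacency (Fin m) → ℕ
β {m} adj = length (filterᵇ (isIsolated adj) (allFin m))

-- corona product G ⊙ H: vertex inj₁ i is v_i of G, inj₂ (i , x) is vertex x of copy H_i
CoronaV : ℕ → ℕ → Set
CoronaV n m = Fin n ⊎ (Fin n × Fin m)

corona : {n m : ℕ} → Adjacency (Fin n) → Adjacency (Fin m) → Adjacency (CoronaV n m)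
corona G H (inj₁ a) (inj₁ b) = G a b
corona G H (inj₁ a) (inj₂ (i , x)) = ⌊ a ≟ i ⌋
corona G H (inj₂ (i , x)) (inj₁ a) = ⌊ i ≟ a ⌋
corona G H (inj₂ (i , x)) (inj₂ (j , y)) = ⌊ i ≟ j ⌋ ∧ H x y

module Submission where

-- Suppose t ≤ β(H) and let Π be a resolving partition of G ⊙ H
-- with t parts.  In the copy H_i, every isolated vertex of H has v_i as its
-- only neighbour, so two such vertices are twins (same neighbourhood); twins
-- in the same part have the same representation.  Hence Π separates the
-- β(H) isolated vertices of H_i, and as t ≤ β(H) they meet every part.
-- Since t ≤ β(H) < n, two hubs v_i ≠ v_j lie in a common part P.  Take the
-- isolated vertices x ∈ H_i and y ∈ H_j lying in P: both are at distance 0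
-- from P and, being pendant at a hub that sees every part, at distance 2
-- from every other part.  So r(x|Π) = r(y|Π), a contradiction.
--
-- The argument
-- does not need G, H simple, G connected, n ≥ 2 or β(H) ≥ 2.

open import Defs
open import Data.Nat using (ℕ; _≤_; _<_; _+_; zero; suc; z≤n; s≤s; _<?_)
open import Data.Nat.Properties using (≤-antisym; ≤-<-trans; ≮⇒≥; ≤⇒≯; +-comm)
open import Data.Fin using (Fin; _≟_; punchOut)
open import Data.Fin.Properties using (pigeonhole; punchOut-injective; injective⇒≤; any?; <⇒≢)
open import Data.Bool using (T; false)
open import Data.Bool.Properties using (T-not-≡; T-∧)
open import Data.List using (List; _∷_; filterᵇ; allFin; lookup)
import Data.List.Relation.Unary.All as All
open import Data.List.Relation.Unary.All.Properties using (all⁺)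
open import Data.List.Relation.Unary.AllPairs using (_∷_)
open import Data.List.Relation.Unary.Unique.Propositional using (Unique)
open import Data.List.Relation.Unary.Unique.Propositional.Properties using (allFin⁺; filter⁺)
open import Data.List.Membership.Propositional.Properties using (∈-filter⁻; ∈-lookup; ∈-allFin)
open import Data.Product using (∃; _×_; _,_; proj₂)
open import Data.Sum using (inj₁; inj₂)
open import Data.Sum.Properties using (inj₂-injective)
open import Data.Product.Properties using (,-injectiveˡ; ,-injectiveʳ)
open import Data.Empty using (⊥; ⊥-elim)
open import Relation.Nullary using (¬_; yes; no)
open import Relation.Nullary.Decidable using (T?; toWitness; fromWitness)
open import Relation.Binary.PropositionalEquality using (_≡_; refl; sym; trans; cong; subst; _≢_)
open import Function using (_∘_)
open import Function.Bundles using (Equivalence)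
open import Function.Definitions using (Injective)

module _ {V : Set} (adj : Adjacency V) where

  SameNbhd : V → V → Set
  SameNbhd u v = ∀ w → adj u w ≡ adj v w

  PendantAt : V → V → Set
  PendantAt u c = T (adj u c) × (∀ w → T (adj u w) → w ≡ c)

  SeesAllParts : ∀ {t} → (V → Fin t) → V → Set
  SeesAllParts part c = ∀ p → ∃ λ y → T (adj c y) × part y ≡ p

  walk-zero : ∀ {u z} → Walk adj u z 0 → u ≡ z
  walk-zero here = refl

  dist-self : ∀ u → Dist adj u u 0
  dist-self u = here , λ _ _ → z≤n

  own-part-dist : ∀ {t} {part : V → Fin t} {u i a}
    → part u ≡ i → SetDist adj part i u a → a ≡ 0
  own-part-dist {u = u} u∈i (_ , minimal) with minimal u 0 u∈i (dist-self u)
  ... | z≤n = refl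

  walk-transfer : ∀ {u v z k} → SameNbhd u v → Walk adj u z (suc k) → Walk adj v z (suc k)
  walk-transfer same (step e w) = step (subst T (same _) e) w

  -- For twins u, v in a common part, d(v,P) ≤ d(u,P): a shortest walk from u
  -- to P is either empty (then v ∈ P too) or can be restarted at v.
  twin-dist-≤ : ∀ {t} (part : V → Fin t) {u v i a b}
    → SameNbhd u v → part u ≡ part v
    → SetDist adj part i u a → SetDist adj part i v b → b ≤ a
  twin-dist-≤ part {v = v} {a = zero} same uv ((z , z∈i , wa , _) , _) (_ , minB)
    with walk-zero wa
  ... | refl = minB v 0 (trans (sym uv) z∈i) (dist-self v)
  twin-dist-≤ part {u} {v} {a = suc k} same uv ((z , z∈i , wa , minWa) , minA) (_ , minB) =
    minB z (suc k) z∈i (walk-transfer same wa , shortest)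
    where
    shortest : ∀ l → Walk adj v z l → suc k ≤ l
    shortest zero w with walk-zero w
    ... | refl with minA u 0 (trans uv z∈i) (dist-self u)
    ...   | ()
    shortest (suc l) w = minWa (suc l) (walk-transfer (sym ∘ same) w)

  twins-unresolved : ∀ {t} (part : V → Fin t) {u v}
    → SameNbhd u v → part u ≡ part v → SameRep adj part u v
  twins-unresolved part same uv i a b da db =
    ≤-antisym (twin-dist-≤ part (sym ∘ same) (sym uv) db da) (twin-dist-≤ part same uv da db)

  pendant-far : ∀ {t} (part : V → Fin t) {u c z p k}
    → (∀ w → T (adj u w) → w ≡ c) → part u ≢ p → part c ≢ p
    → part z ≡ p → Walk adj u z k → 2 ≤ k
  pendant-far part only u∉ c∉ z∈ here = ⊥-elim (u∉ z∈)
  pendant-far part only u∉ c∉ z∈ (step e here) with only _ e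
  ... | refl = ⊥-elim (c∉ z∈)
  pendant-far part only u∉ c∉ z∈ (step _ (step _ _)) = s≤s (s≤s z≤n)

  pendant-dist-2 : ∀ {t} (part : V → Fin t) {u c p a}
    → PendantAt u c → (∃ λ y → T (adj c y) × part y ≡ p)
    → part u ≢ p → part c ≢ p → SetDist adj part p u a → a ≡ 2
  pendant-dist-2 part (uc , only) (y , cy , y∈) u∉ c∉ ((_ , z∈ , wa , _) , minimal) =
    ≤-antisym
      (minimal y 2 y∈ (step uc (step cy here) , λ _ → pendant-far part only u∉ c∉ y∈))
      (pendant-far part only u∉ c∉ z∈ wa)

  -- Two pendant vertices, lying in the same part as their neighbours, where
  -- both neighbours see every part, have the same representation:
  -- distance 0 to their own part and 2 to every other part.
  pendants-unresolved : ∀ {t} (part : V → Fin t) {u v c d q}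
    → PendantAt u c → PendantAt v d
    → part u ≡ q → part v ≡ q → part c ≡ q → part d ≡ q
    → SeesAllParts part c → SeesAllParts part d
    → SameRep adj part u v
  pendants-unresolved part {q = q} pu pv u∈ v∈ c∈ d∈ seesC seesD p a b da db with p ≟ q
  ... | yes refl = trans (own-part-dist u∈ da) (sym (own-part-dist v∈ db))
  ... | no p≢q = trans
    (pendant-dist-2 part pu (seesC p) (outside u∈) (outside c∈) da)
    (sym (pendant-dist-2 part pv (seesD p) (outside v∈) (outside d∈) db))
    where
    outside : ∀ {x} → part x ≡ q → part x ≢ p
    outside x∈q x∈p = p≢q (trans (sym x∈p) x∈q)

-- An injection Fin b → Fin t with t ≤ b is onto: missing a value p would
-- give an injection Fin b → Fin (t - 1) after punching out p.
injective-onto : ∀ {b t} → t ≤ b → (f : Fin b → Fin t) → Injective _≡_ _≡_ f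
  → ∀ p → ∃ λ k → f k ≡ p
injective-onto {b} {suc t'} t≤b f inj p with any? (λ k → f k ≟ p)
... | yes hit = hit
... | no miss = ⊥-elim (≤⇒≯ (injective⇒≤ punched-injective) t≤b)
  where
  avoid : ∀ k → p ≢ f k
  avoid k p≡fk = miss (k , sym p≡fk)
  punched : Fin b → Fin t'
  punched k = punchOut (avoid k)
  punched-injective : Injective _≡_ _≡_ punched
  punched-injective {k} {k'} = inj ∘ punchOut-injective (avoid k) (avoid k')

lookup-injective : ∀ {A : Set} {xs : List A} → Unique xs
  → ∀ {k k'} → lookup xs k ≡ lookup xs k' → k ≡ k'
lookup-injective {xs = _ ∷ _} (_ ∷ _) {Fin.zero} {Fin.zero} _ = refl
lookup-injective {xs = _ ∷ xs} (fresh ∷ _) {Fin.zero} {Fin.suc k'} eq =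
  ⊥-elim (All.lookup fresh (∈-lookup {xs = xs} k') eq)
lookup-injective {xs = _ ∷ xs} (fresh ∷ _) {Fin.suc k} {Fin.zero} eq =
  ⊥-elim (All.lookup fresh (∈-lookup {xs = xs} k) (sym eq))
lookup-injective (_ ∷ unique) {Fin.suc k} {Fin.suc k'} eq =
  cong Fin.suc (lookup-injective unique eq)

Isolated : ∀ {m} → Adjacency (Fin m) → Fin m → Set
Isolated H x = ∀ y → H x y ≡ false

module IsolatedVertices {m : ℕ} (H : Adjacency (Fin m)) where

  isolatedList : List (Fin m)
  isolatedList = filterᵇ (isIsolated H) (allFin m)

  isolated : Fin (β H) → Fin m
  isolated = lookup isolatedList

  isolated-injective : Injective _≡_ _≡_ isolated
  isolated-injective = lookup-injective (filter⁺ (T? ∘ isIsolated H) (allFin⁺ m))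

  isolated-isolated : ∀ k → Isolated H (isolated k)
  isolated-isolated k y =
    Equivalence.to T-not-≡ (All.lookup (all⁺ _ (allFin m) listed-isolated) (∈-allFin y))
    where
    listed-isolated : T (isIsolated H (isolated k))
    listed-isolated =
      proj₂ (∈-filter⁻ (T? ∘ isIsolated H) {xs = allFin m} (∈-lookup {xs = isolatedList} k))

module CoronaProperties {n m : ℕ} (G : Adjacency (Fin n)) (H : Adjacency (Fin m)) where

  hub-adjacent : ∀ i x → T (corona G H (inj₁ i) (inj₂ (i , x)))
  hub-adjacent i x = fromWitness refl

  isolated-pendant : ∀ {x} → Isolated H x → ∀ i → PendantAt (corona G H) (inj₂ (i , x)) (inj₁ i)
  isolated-pendant {x} x-isolated i = fromWitness refl , only-neighbour
    where
    only-neighbour : ∀ w → T (corona G H (inj₂ (i , x)) w) → w ≡ inj₁ i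
    only-neighbour (inj₁ a) e = cong inj₁ (sym (toWitness e))
    only-neighbour (inj₂ (j , y)) e =
      ⊥-elim (subst T (x-isolated y) (proj₂ (Equivalence.to T-∧ e)))

  isolated-twins : ∀ {x y} → Isolated H x → Isolated H y
    → ∀ i → SameNbhd (corona G H) (inj₂ (i , x)) (inj₂ (i , y))
  isolated-twins x-isolated y-isolated i (inj₁ a) = refl
  isolated-twins x-isolated y-isolated i (inj₂ (j , z))
    rewrite x-isolated z | y-isolated z = refl

module FewParts {n m : ℕ} (G : Adjacency (Fin n)) (H : Adjacency (Fin m))
  {t : ℕ} (part : CoronaV n m → Fin t)
  (resolving : ∀ u v → ¬ (u ≡ v) → ¬ SameRep (corona G H) part u v)
  (t≤β : t ≤ β H) where

  open IsolatedVertices H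
  open CoronaProperties G H

  -- Since twins in a common part are unresolved, Π separates the isolated
  -- vertices of each copy H_i.
  copy-separated : ∀ i → Injective _≡_ _≡_ (λ k → part (inj₂ (i , isolated k)))
  copy-separated i {k} {k'} same-part with k ≟ k'
  ... | yes k≡k' = k≡k'
  ... | no k≢k' = ⊥-elim (resolving _ _ distinct
        (twins-unresolved _ part
          (isolated-twins (isolated-isolated k) (isolated-isolated k') i) same-part))
    where
    distinct : inj₂ (i , isolated k) ≢ inj₂ (i , isolated k')
    distinct = k≢k' ∘ isolated-injective ∘ ,-injectiveʳ ∘ inj₂-injective

  copy-meets-every-part : ∀ i p → ∃ λ k → part (inj₂ (i , isolated k)) ≡ p
  copy-meets-every-part i = injective-onto t≤β _ (copy-separated i)

  hub-sees-all-parts : ∀ i → SeesAllParts (corona G H) part (inj₁ i)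
  hub-sees-all-parts i p with copy-meets-every-part i p
  ... | k , k∈p = inj₂ (i , isolated k) , hub-adjacent i (isolated k) , k∈p

  -- If also β(H) < n, two hubs share a part, and the isolated vertices of
  -- their copies lying in that part are unresolved pendant vertices.
  not-fewer-than-hubs : β H < n → ⊥
  not-fewer-than-hubs β<n with pigeonhole (≤-<-trans t≤β β<n) (part ∘ inj₁)
  ... | i , j , i<j , same-hub-part
    with copy-meets-every-part i (part (inj₁ i)) | copy-meets-every-part j (part (inj₁ i))
  ... | x , x∈ | y , y∈ = resolving _ _ distinct
        (pendants-unresolved _ part
          (isolated-pendant (isolated-isolated x) i) (isolated-pendant (isolated-isolated y) j)
          x∈ y∈ refl (sym same-hub-part) (hub-sees-all-parts i) (hub-sees-all-parts j))
    where
    distinct : inj₂ (i , isolated x) ≢ inj₂ (j , isolated y)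
    distinct = <⇒≢ i<j ∘ ,-injectiveˡ ∘ inj₂-injective

theorem14 : (n m : ℕ) (G : Adjacency (Fin n)) (H : Adjacency (Fin m))
    → IsSimple G → IsSimple H → Connected G → 2 ≤ n
    → 2 ≤ β H → β H < n
    → (t : ℕ) (part : CoronaV n m → Fin t)
    → IsResolvingPartition (corona G H) t part
    → β H + 1 ≤ t
theorem14 n m G H _ _ _ _ _ β<n t part (_ , resolving) with β H <? t
... | yes β<t = subst (_≤ t) (+-comm 1 (β H)) β<t
... | no β≮t = ⊥-elim (FewParts.not-fewer-than-hubs G H part resolving (≮⇒≥ β≮t) β<n)
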